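{- Let $\{P_n\}_{n\geq 0}$ be the sequence defined by $P_0=1$, $P_1=8$ and, for $n\geq 1$, $(n+1)^2P_{n+1}=8(3n^2+3n+1)P_n-128n^2P_{n-1}$. Then the sequence $\{\sqrt[n]{P_n}\}_{n\geq 1}$ is strictly log-concave, that is, for all $n\geq 2$, $$\left(\sqrt[n]{P_n}\right)^2>\sqrt[n-1]{P_{n-1}}\cdot\sqrt[n+1]{P_{n+1}}.$$
   Context: $\{P_n\}$ is the Catalan-Larcombe-French sequence; all its terms are positive. -}

module Defs where

open import Data.Nat using (ℕ; zero; suc)
open import Data.Integer using (+_)
open import Data.Rational using (ℚ; _/_; _*_; 1ℚ)

ℕ→ℚ : ℕ → ℚ
ℕ→ℚ k = (+ k) / 1

_^ℚ_ : ℚ → ℕ → ℚ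
q ^ℚ zero  = 1ℚ
q ^ℚ suc n = q * (q ^ℚ n)

infixr 8 _^ℚ_

{-# OPTIONS --safe #-}
-- Write Dₙ = 2(n² − 1) log Pₙ − n(n + 1) log Pₙ₋₁ − n(n − 1) log Pₙ₊₁, so that the claim is Dₙ > 0.
-- Expanding gives Dₙ₊₁ − Dₙ = −n(n + 1) Δ³ₙ with Δ³ₙ = log Pₙ₊₂ − 3 log Pₙ₊₁ + 3 log Pₙ − log Pₙ₋₁,
-- so it suffices that D₂ > 0 and Pₙ³ Pₙ₊₂ ≤ Pₙ₊₁³ Pₙ₋₁ for n ≥ 2. For n ≥ 4 the ratio Pₙ₊₁ / Pₙ
-- lies in [16(n − 1)/n, 16n/(n + 1)], an interval that the recurrence maps into the next one.
-- Eliminating Pₙ₋₁ and Pₙ₊₂ with the recurrence turns the cubic inequality into the nonnegativity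
-- of a binary quartic in the (scaled) distances Z, W of Pₙ₊₁ / Pₙ to the two ends of that interval,
-- whose coefficients are polynomials in n − 2 with nonnegative coefficients. The cases n = 2, 3 and
-- D₂ > 0 are finite computations.
module Submission where

open import Defs
open import Data.Nat using (ℕ; suc; _≤_; _∸_) renaming (_*_ to _*ℕ_; _+_ to _+ℕ_)
open import Data.Rational using (ℚ; _+_; _-_; _*_; _<_)
open import Relation.Binary.PropositionalEquality using (_≡_)

open import Agda.Builtin.FromNat using (Number; fromNat)
open import Algebra.Bundles using (CommutativeMonoid)
import Algebra.Properties.CommutativeSemigroup as CommutativeSemigroup
open import Data.Integer.Base as ℤ using (+_)
import Data.Integer.Properties as ℤ
open import Data.Nat.Base using (zero; z≤n; s≤s)
import Data.Nat.Coprimality as Coprime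
open import Data.Nat.Literals using () renaming (number to ℕ-literals)
import Data.Nat.Properties as ℕ
open import Data.Nat.Tactic.RingSolver using () renaming (solve-∀ to ℕ-solve-∀)
open import Data.Product.Base using (_×_; _,_; proj₁; proj₂)
open import Data.Rational
  using (mkℚ; _/_; -_; 0ℚ; 1ℚ; *≤*; NonNegative; nonNegative; positive) renaming (_≤_ to _≤ℚ_)
open import Data.Rational.Literals using () renaming (number to ℚ-literals)
import Data.Rational.Properties as ℚ
open import Data.Unit.Base using (tt)
open import Level using (0ℓ)
open import Relation.Binary.PropositionalEquality
  using (refl; sym; trans; cong; cong₂; subst; subst₂; module ≡-Reasoning)
open import Relation.Nullary.Decidable using (dec⇒maybe; from-yes; toWitness)
open import Tactic.RingSolver using (solve-∀)
open import Tactic.RingSolver.Core.AlmostCommutativeRing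
  using (AlmostCommutativeRing; fromCommutativeRing)

-- With fromNat in scope every numeral is overloaded, so ℕ needs an instance as well as ℚ.
instance
  ℕ-number : Number ℕ
  ℕ-number = ℕ-literals

  ℚ-number : Number ℚ
  ℚ-number = ℚ-literals

ℚ-ring : AlmostCommutativeRing 0ℓ 0ℓ
ℚ-ring = fromCommutativeRing ℚ.+-*-commutativeRing (λ x → dec⇒maybe (0ℚ ℚ.≟ x))

open CommutativeSemigroup (CommutativeMonoid.commutativeSemigroup ℚ.*-1-commutativeMonoid)
  using (x∙yz≈y∙xz; interchange)

private
  variable
    m n : ℕ
    p q r x y : ℚ

ℕ→ℚ≡mkℚ : ∀ n → ℕ→ℚ n ≡ mkℚ (+ n) 0 (Coprime.sym (Coprime.1-coprimeTo n))
ℕ→ℚ≡mkℚ n = ℚ.normalize-coprime (Coprime.sym (Coprime.1-coprimeTo n))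

ℕ→ℚ-homo-+ : ∀ m n → ℕ→ℚ (m +ℕ n) ≡ ℕ→ℚ m + ℕ→ℚ n
ℕ→ℚ-homo-+ m n = begin
  + (m +ℕ n) / 1                    ≡⟨ cong (_/ 1) (trans (ℤ.pos-+ m n) (sym +m*1++n*1≡+m++n)) ⟩
  (+ m ℤ.* + 1 ℤ.+ + n ℤ.* + 1) / 1 ≡⟨ sym (cong₂ _+_ (ℕ→ℚ≡mkℚ m) (ℕ→ℚ≡mkℚ n)) ⟩
  ℕ→ℚ m + ℕ→ℚ n                     ∎
  where
  open ≡-Reasoning
  +m*1++n*1≡+m++n : + m ℤ.* + 1 ℤ.+ + n ℤ.* + 1 ≡ + m ℤ.+ + n
  +m*1++n*1≡+m++n = cong₂ ℤ._+_ (ℤ.*-identityʳ (+ m)) (ℤ.*-identityʳ (+ n))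

ℕ→ℚ-homo-* : ∀ m n → ℕ→ℚ (m *ℕ n) ≡ ℕ→ℚ m * ℕ→ℚ n
ℕ→ℚ-homo-* m n = begin
  + (m *ℕ n) / 1    ≡⟨ cong (_/ 1) (ℤ.pos-* m n) ⟩
  (+ m ℤ.* + n) / 1 ≡⟨ sym (cong₂ _*_ (ℕ→ℚ≡mkℚ m) (ℕ→ℚ≡mkℚ n)) ⟩
  ℕ→ℚ m * ℕ→ℚ n     ∎
  where open ≡-Reasoning

ℕ→ℚ-suc : ∀ n → ℕ→ℚ (suc n) ≡ ℕ→ℚ n + 1
ℕ→ℚ-suc n = trans (cong ℕ→ℚ (ℕ.+-comm 1 n)) (ℕ→ℚ-homo-+ n 1)

ℕ→ℚ-mono-≤ : m ≤ n → ℕ→ℚ m ≤ℚ ℕ→ℚ n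
ℕ→ℚ-mono-≤ {m} {n} m≤n rewrite ℕ→ℚ≡mkℚ m | ℕ→ℚ≡mkℚ n =
  *≤* (subst₂ ℤ._≤_ (sym (ℤ.*-identityʳ (+ m))) (sym (ℤ.*-identityʳ (+ n))) (ℤ.+≤+ m≤n))

p<q⇒0<q-p : p < q → 0ℚ < q - p
p<q⇒0<q-p {p} {q} p<q = subst (_< q - p) (ℚ.+-inverseʳ p) (ℚ.+-monoˡ-< (- p) p<q)

p≤q⇒0≤q-p : p ≤ℚ q → 0ℚ ≤ℚ q - p
p≤q⇒0≤q-p {p} {q} p≤q = subst (_≤ℚ q - p) (ℚ.+-inverseʳ p) (ℚ.+-monoˡ-≤ (- p) p≤q)

0≤q-p⇒p≤q : 0ℚ ≤ℚ q - p → p ≤ℚ q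
0≤q-p⇒p≤q {q} {p} 0≤q-p = subst₂ _≤ℚ_ (ℚ.+-identityˡ p) (q-p+p≡q q p) (ℚ.+-monoˡ-≤ p 0≤q-p)
  where
  q-p+p≡q : ∀ q p → q - p + p ≡ q
  q-p+p≡q = solve-∀ ℚ-ring

*-pos : 0ℚ < p → 0ℚ < q → 0ℚ < p * q
*-pos {p} {q} 0<p 0<q = ℚ.positive⁻¹ _ {{ℚ.pos*pos⇒pos p {{positive 0<p}} q {{positive 0<q}}}}

*-cancelˡ-pos : 0ℚ ≤ℚ r → 0ℚ < r * p → 0ℚ < p
*-cancelˡ-pos {r} {p} 0≤r 0<rp =
  ℚ.*-cancelˡ-<-nonNeg r {{nonNegative 0≤r}} (subst (_< r * p) (sym (ℚ.*-zeroʳ r)) 0<rp)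

*-cancelˡ-nonNeg : 0ℚ < r → 0ℚ ≤ℚ r * p → 0ℚ ≤ℚ p
*-cancelˡ-nonNeg {r} {p} 0<r 0≤rp =
  ℚ.*-cancelˡ-≤-pos r {{positive 0<r}} (subst (_≤ℚ r * p) (sym (ℚ.*-zeroʳ r)) 0≤rp)

*-cancelˡ-≡ : 0ℚ < r → r * p ≡ r * q → p ≡ q
*-cancelˡ-≡ {r} 0<r rp≡rq = ℚ.≤-antisym (cancel rp≡rq) (cancel (sym rp≡rq))
  where
  cancel : ∀ {p q} → r * p ≡ r * q → p ≤ℚ q
  cancel rp≡rq = ℚ.*-cancelˡ-≤-pos r {{positive 0<r}} (ℚ.≤-reflexive rp≡rq)

x≡y⇒p+r*[x-y]≡p : ∀ p r {x y} → x ≡ y → p + r * (x - y) ≡ p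
x≡y⇒p+r*[x-y]≡p p r {x} refl = begin
  p + r * (x - x) ≡⟨ cong (λ t → p + r * t) (ℚ.+-inverseʳ x) ⟩
  p + r * 0ℚ      ≡⟨ cong (λ t → p + t) (ℚ.*-zeroʳ r) ⟩
  p + 0ℚ          ≡⟨ ℚ.+-identityʳ p ⟩
  p               ∎
  where open ≡-Reasoning

-- A nonnegativity proof built from _⊕_, _⊛_ and lit copies the shape of its expression, and
-- unification recovers the subexpressions from the goal.

infixl 6 _⊕_
infixl 7 _⊛_

_⊕_ : 0ℚ ≤ℚ p → 0ℚ ≤ℚ q → 0ℚ ≤ℚ p + q
_⊕_ = ℚ.+-mono-≤

_⊛_ : 0ℚ ≤ℚ p → 0ℚ ≤ℚ q → 0ℚ ≤ℚ p * q
_⊛_ {p} {q} 0≤p 0≤q =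
  ℚ.nonNegative⁻¹ _ {{ℚ.nonNeg*nonNeg⇒nonNeg p {{nonNegative 0≤p}} q {{nonNegative 0≤q}}}}

lit : {{NonNegative p}} → 0ℚ ≤ℚ p
lit {p} = ℚ.nonNegative⁻¹ p

^ℚ-homo-* : ∀ x m n → x ^ℚ (m +ℕ n) ≡ x ^ℚ m * x ^ℚ n
^ℚ-homo-* x zero    n = sym (ℚ.*-identityˡ (x ^ℚ n))
^ℚ-homo-* x (suc m) n = trans (cong (x *_) (^ℚ-homo-* x m n)) (sym (ℚ.*-assoc x _ _))

^ℚ-assocʳ : ∀ x m n → (x ^ℚ m) ^ℚ n ≡ x ^ℚ (m *ℕ n)
^ℚ-assocʳ x m zero    = cong (x ^ℚ_) (sym (ℕ.*-zeroʳ m))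
^ℚ-assocʳ x m (suc n) = begin
  x ^ℚ m * (x ^ℚ m) ^ℚ n ≡⟨ cong (x ^ℚ m *_) (^ℚ-assocʳ x m n) ⟩
  x ^ℚ m * x ^ℚ (m *ℕ n) ≡⟨ sym (^ℚ-homo-* x m (m *ℕ n)) ⟩
  x ^ℚ (m +ℕ m *ℕ n)     ≡⟨ cong (x ^ℚ_) (sym (ℕ.*-suc m n)) ⟩
  x ^ℚ (m *ℕ suc n)      ∎
  where open ≡-Reasoning

^ℚ-distrib-* : ∀ x y n → (x * y) ^ℚ n ≡ x ^ℚ n * y ^ℚ n
^ℚ-distrib-* x y zero    = sym (ℚ.*-identityˡ 1ℚ)
^ℚ-distrib-* x y (suc n) =
  trans (cong (x * y *_) (^ℚ-distrib-* x y n)) (interchange x y (x ^ℚ n) (y ^ℚ n))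

x^3≡x*x*x : ∀ x → x ^ℚ 3 ≡ x * x * x
x^3≡x*x*x x = trans (cong (λ t → x * (x * t)) (ℚ.*-identityʳ x)) (sym (ℚ.*-assoc x x x))

^ℚ-pos : ∀ n → 0ℚ < x → 0ℚ < x ^ℚ n
^ℚ-pos zero    0<x = ℚ.positive⁻¹ 1ℚ
^ℚ-pos (suc n) 0<x = *-pos 0<x (^ℚ-pos n 0<x)

^ℚ-nonNeg : ∀ n → 0ℚ ≤ℚ x → 0ℚ ≤ℚ x ^ℚ n
^ℚ-nonNeg zero    0≤x = lit
^ℚ-nonNeg (suc n) 0≤x = 0≤x ⊛ ^ℚ-nonNeg n 0≤x

^ℚ-mono-≤ : ∀ n → 0ℚ ≤ℚ x → x ≤ℚ y → x ^ℚ n ≤ℚ y ^ℚ n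
^ℚ-mono-≤ zero 0≤x x≤y = ℚ.≤-refl
^ℚ-mono-≤ {x} {y} (suc n) 0≤x x≤y = begin
  x * x ^ℚ n ≤⟨ ℚ.*-monoʳ-≤-nonNeg (x ^ℚ n) {{nonNegative (^ℚ-nonNeg n 0≤x)}} x≤y ⟩
  y * x ^ℚ n ≤⟨ ℚ.*-monoˡ-≤-nonNeg y {{nonNegative (ℚ.≤-trans 0≤x x≤y)}} (^ℚ-mono-≤ n 0≤x x≤y) ⟩
  y * y ^ℚ n ∎
  where open ℚ.≤-Reasoning

x^i*[y^e*x^j]≡[x³y]^e : ∀ x y i j e → i +ℕ j ≡ 3 *ℕ e → x ^ℚ i * (y ^ℚ e * x ^ℚ j) ≡ (x ^ℚ 3 * y) ^ℚ e
x^i*[y^e*x^j]≡[x³y]^e x y i j e i+j≡3e = begin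
  x ^ℚ i * (y ^ℚ e * x ^ℚ j) ≡⟨ x∙yz≈y∙xz (x ^ℚ i) (y ^ℚ e) (x ^ℚ j) ⟩
  y ^ℚ e * (x ^ℚ i * x ^ℚ j) ≡⟨ cong (y ^ℚ e *_) (sym (^ℚ-homo-* x i j)) ⟩
  y ^ℚ e * x ^ℚ (i +ℕ j)     ≡⟨ cong (λ k → y ^ℚ e * x ^ℚ k) i+j≡3e ⟩
  y ^ℚ e * x ^ℚ (3 *ℕ e)     ≡⟨ cong (y ^ℚ e *_) (sym (^ℚ-assocʳ x 3 e)) ⟩
  y ^ℚ e * (x ^ℚ 3) ^ℚ e     ≡⟨ ℚ.*-comm (y ^ℚ e) _ ⟩
  (x ^ℚ 3) ^ℚ e * y ^ℚ e     ≡⟨ sym (^ℚ-distrib-* (x ^ℚ 3) y e) ⟩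
  (x ^ℚ 3 * y) ^ℚ e          ∎
  where open ≡-Reasoning

-- (aₙ^(1/n))² > aₙ₋₁^(1/(n−1)) · aₙ₊₁^(1/(n+1)), raised to the power n(n² − 1).
RootLogConcaveAt : (ℕ → ℚ) → ℕ → Set
RootLogConcaveAt a n =
  a (n ∸ 1) ^ℚ (n *ℕ (n +ℕ 1)) * a (suc n) ^ℚ (n *ℕ (n ∸ 1)) < a n ^ℚ (2 *ℕ (n *ℕ n ∸ 1))

-- Writing Lₙ < Rₙ for RootLogConcaveAt a n and e = n(n + 1), the exponents are arranged so that
-- Lₙ₊₁ · Rₙ = (aₙ³ aₙ₊₂)^e and Rₙ₊₁ · Lₙ = (aₙ₊₁³ aₙ₋₁)^e.
rootLogConcaveAt-suc : ∀ (a : ℕ → ℚ) n → 1 ≤ n →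
  0ℚ < a n → 0ℚ < a (suc n) → 0ℚ ≤ℚ a (suc (suc n)) →
  a n ^ℚ 3 * a (suc (suc n)) ≤ℚ a (suc n) ^ℚ 3 * a (n ∸ 1) →
  RootLogConcaveAt a n → RootLogConcaveAt a (suc n)
rootLogConcaveAt-suc a (suc m) _ 0<a₁ 0<a₂ 0≤a₃ a₁³a₃≤a₂³a₀ L<R =
  ℚ.*-cancelʳ-<-nonNeg R {{nonNegative (ℚ.<⇒≤ (^ℚ-pos j₁ 0<a₁))}} (begin-strict
    L′ * R                   ≡⟨ ℚ.*-assoc (a₁ ^ℚ i₁) (a₃ ^ℚ f) R ⟩
    a₁ ^ℚ i₁ * (a₃ ^ℚ f * R) ≡⟨ cong (λ k → a₁ ^ℚ i₁ * (a₃ ^ℚ k * R)) (f≡e m) ⟩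
    a₁ ^ℚ i₁ * (a₃ ^ℚ e * R) ≡⟨ x^i*[y^e*x^j]≡[x³y]^e a₁ a₃ i₁ j₁ e (i₁+j₁≡3e m) ⟩
    (a₁ ^ℚ 3 * a₃) ^ℚ e      ≤⟨ ^ℚ-mono-≤ e (^ℚ-nonNeg 3 (ℚ.<⇒≤ 0<a₁) ⊛ 0≤a₃) a₁³a₃≤a₂³a₀ ⟩
    (a₂ ^ℚ 3 * a₀) ^ℚ e      ≡⟨ sym (x^i*[y^e*x^j]≡[x³y]^e a₂ a₀ i₂ j₂ e (i₂+j₂≡3e m)) ⟩
    R′ * L                   <⟨ ℚ.*-monoʳ-<-pos R′ {{positive (^ℚ-pos i₂ 0<a₂)}} L<R ⟩
    R′ * R                   ∎)
  where
  open ℚ.≤-Reasoning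
  a₀ a₁ a₂ a₃ L R L′ R′ : ℚ
  e i₁ j₁ i₂ j₂ f : ℕ
  -- j₂, j₁ (at n = m + 1) and i₂ (at n = m + 2) are n(n ∸ 1) and 2(n * n ∸ 1) in the ∸-free
  -- form they reduce to, which the ℕ solver needs.
  a₀ = a m
  a₁ = a (suc m)
  a₂ = a (suc (suc m))
  a₃ = a (suc (suc (suc m)))
  e  = suc m *ℕ (suc m +ℕ 1)
  i₁ = suc (suc m) *ℕ (suc (suc m) +ℕ 1)
  j₁ = 2 *ℕ (m +ℕ m *ℕ suc m)
  i₂ = 2 *ℕ (suc m +ℕ suc m *ℕ suc (suc m))
  j₂ = suc m *ℕ m
  f  = suc (suc m) *ℕ suc m
  L  = a₀ ^ℚ e * a₂ ^ℚ j₂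
  R  = a₁ ^ℚ j₁
  L′ = a₁ ^ℚ i₁ * a₃ ^ℚ f
  R′ = a₂ ^ℚ i₂
  f≡e : ∀ k → suc (suc k) *ℕ suc k ≡ suc k *ℕ (suc k +ℕ 1)
  f≡e = ℕ-solve-∀
  i₁+j₁≡3e : ∀ k →
    suc (suc k) *ℕ (suc (suc k) +ℕ 1) +ℕ 2 *ℕ (k +ℕ k *ℕ suc k) ≡ 3 *ℕ (suc k *ℕ (suc k +ℕ 1))
  i₁+j₁≡3e = ℕ-solve-∀
  i₂+j₂≡3e : ∀ k →
    2 *ℕ (suc k +ℕ suc k *ℕ suc (suc k)) +ℕ suc k *ℕ k ≡ 3 *ℕ (suc k *ℕ (suc k +ℕ 1))
  i₂+j₂≡3e = ℕ-solve-∀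

rootLogConcave : (a : ℕ → ℚ) → (∀ n → 0ℚ < a n) →
  (∀ n → 2 ≤ n → a n ^ℚ 3 * a (suc (suc n)) ≤ℚ a (suc n) ^ℚ 3 * a (n ∸ 1)) →
  RootLogConcaveAt a 2 → ∀ n → 2 ≤ n → RootLogConcaveAt a n
rootLogConcave a 0<a logΔ³≤0 base = from-2
  where
  from-2 : ∀ n → 2 ≤ n → RootLogConcaveAt a n
  from-2 2 _ = base
  from-2 (suc n@(suc (suc _))) _ =
    rootLogConcaveAt-suc a n (s≤s z≤n) (0<a _) (0<a _) (ℚ.<⇒≤ (0<a _))
      (logΔ³≤0 n (s≤s (s≤s z≤n))) (from-2 n (s≤s (s≤s z≤n)))
  from-2 1 (s≤s ())

-- With N = n and (p, u, v) = (Pₙ₋₁, Pₙ, Pₙ₊₁).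
Recurrence : ℚ → ℚ → ℚ → ℚ → Set
Recurrence N p u v = (N + 1) * (N + 1) * v ≡ 8 * (3 * (N * N) + 3 * N + 1) * u - 128 * (N * N) * p

RatioBounds : ℚ → ℚ → ℚ → Set
RatioBounds N u v = 16 * (N - 1) * u ≤ℚ N * v × (N + 1) * v ≤ℚ 16 * N * u

-- In the three identities below Z and W are the two gaps of RatioBounds N u v, and the trailing
-- summands are multiples of lhs − rhs of a recurrence, so they vanish on solutions. The coefficients
-- come from writing u and v in the coordinates Z, W: 16u = (N + 1)Z + NW and v = NZ + (N − 1)W.

lowerGap-certificate : ∀ (N u v w : ℚ) →
  let K = N - 4
      Z = N * v - 16 * (N - 1) * u
      W = 16 * N * u - (N + 1) * v
  in (N + 2) * (N + 2) * ((N + 1) * w - 16 * (N + 1 - 1) * v)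
       ≡ (344 + K * (152 + K * 16)) * Z + (8 + K * (48 + K * 8)) * W
         + (N + 1) * ((N + 1 + 1) * (N + 1 + 1) * w
                      - (8 * (3 * ((N + 1) * (N + 1)) + 3 * (N + 1) + 1) * v - 128 * ((N + 1) * (N + 1)) * u))
lowerGap-certificate = solve-∀ ℚ-ring

upperGap-certificate : ∀ (N u v w : ℚ) →
  let K = N - 4
      Z = N * v - 16 * (N - 1) * u
      W = 16 * N * u - (N + 1) * v
  in (N + 2) * (N + 2) * (16 * (N + 1) * v - (N + 1 + 1) * w)
       ≡ (48 + K * 8) * Z + (336 + K * (104 + K * 8)) * W
         + (N + 2) * ((8 * (3 * ((N + 1) * (N + 1)) + 3 * (N + 1) + 1) * v - 128 * ((N + 1) * (N + 1)) * u)
                      - (N + 1 + 1) * (N + 1 + 1) * w)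
upperGap-certificate = solve-∀ ℚ-ring

logThirdDifference-certificate : ∀ (N p u v w : ℚ) →
  let K = N - 2
      Z = N * v - 16 * (N - 1) * u
      W = 16 * N * u - (N + 1) * v
  in 512 * (N * N) * ((N + 2) * (N + 2)) * (v * v * v * p - u * u * u * w)
       ≡ (300 + K * (616 + K * (499 + K * (199 + K * (39 + K * 3))))) * (Z * Z * Z * Z)
         + (980 + K * (2384 + K * (2273 + K * (1075 + K * (260 + K * (29 + K)))))) * (Z * Z * Z * W)
         + (840 + K * (2652 + K * (3114 + K * (1755 + K * (498 + K * (66 + K * 3)))))) * (Z * Z * W * W)
         + (272 + K * (1088 + K * (1634 + K * (1126 + K * (375 + K * (57 + K * 3)))))) * (Z * W * W * W)
         + (32 + K * (144 + K * (280 + K * (246 + K * (98 + K * (17 + K)))))) * (W * W * W * W)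
         + 4 * ((N + 2) * (N + 2)) * (v * v * v)
             * ((N + 1) * (N + 1) * v - (8 * (3 * (N * N) + 3 * N + 1) * u - 128 * (N * N) * p))
         + 512 * (N * N) * (u * u * u)
             * ((8 * (3 * ((N + 1) * (N + 1)) + 3 * (N + 1) + 1) * v - 128 * ((N + 1) * (N + 1)) * u)
                - (N + 1 + 1) * (N + 1 + 1) * w)
logThirdDifference-certificate = solve-∀ ℚ-ring

ratioBounds-pos : ∀ {N u v} → 1 < N → 0ℚ < u → RatioBounds N u v → 0ℚ < v
ratioBounds-pos 1<N 0<u (lower , _) =
  *-cancelˡ-pos (ℚ.<⇒≤ (ℚ.<-trans (ℚ.positive⁻¹ 1) 1<N))
    (ℚ.<-≤-trans (*-pos (*-pos (ℚ.positive⁻¹ 16) (p<q⇒0<q-p 1<N)) 0<u) lower)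

ratioBounds-step : ∀ {N u v w} → 4 ≤ℚ N → Recurrence (N + 1) u v w →
  RatioBounds N u v → RatioBounds (N + 1) v w
ratioBounds-step {N} {u} {v} {w} 4≤N rec (lower , upper) =
  0≤q-p⇒p≤q (*-cancelˡ-nonNeg 0<[N+2]²
    (subst (0ℚ ≤ℚ_) (sym (trans (lowerGap-certificate N u v w) (x≡y⇒p+r*[x-y]≡p _ (N + 1) rec)))
      ((lit ⊕ κ ⊛ (lit ⊕ κ ⊛ lit)) ⊛ ζ ⊕ (lit ⊕ κ ⊛ (lit ⊕ κ ⊛ lit)) ⊛ ω))) ,
  0≤q-p⇒p≤q (*-cancelˡ-nonNeg 0<[N+2]²
    (subst (0ℚ ≤ℚ_) (sym (trans (upperGap-certificate N u v w) (x≡y⇒p+r*[x-y]≡p _ (N + 2) (sym rec))))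
      ((lit ⊕ κ ⊛ lit) ⊛ ζ ⊕ (lit ⊕ κ ⊛ (lit ⊕ κ ⊛ lit)) ⊛ ω)))
  where
  κ : 0ℚ ≤ℚ N - 4
  κ = p≤q⇒0≤q-p 4≤N
  ζ : 0ℚ ≤ℚ N * v - 16 * (N - 1) * u
  ζ = p≤q⇒0≤q-p lower
  ω : 0ℚ ≤ℚ 16 * N * u - (N + 1) * v
  ω = p≤q⇒0≤q-p upper
  0<N+2 : 0ℚ < N + 2
  0<N+2 = ℚ.+-mono-< (ℚ.<-≤-trans (ℚ.positive⁻¹ 4) 4≤N) (ℚ.positive⁻¹ 2)
  0<[N+2]² : 0ℚ < (N + 2) * (N + 2)
  0<[N+2]² = *-pos 0<N+2 0<N+2

logThirdDifference≤0 : ∀ {N p u v w} → 2 ≤ℚ N → Recurrence N p u v → Recurrence (N + 1) u v w →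
  RatioBounds N u v → u ^ℚ 3 * w ≤ℚ v ^ℚ 3 * p
logThirdDifference≤0 {N} {p} {u} {v} {w} 2≤N rec₀ rec₁ (lower , upper) =
  0≤q-p⇒p≤q (*-cancelˡ-nonNeg 0<scale (subst (0ℚ ≤ℚ_) (sym (begin
    512 * (N * N) * ((N + 2) * (N + 2)) * (v ^ℚ 3 * p - u ^ℚ 3 * w)
      ≡⟨ cong₂ (λ s t → 512 * (N * N) * ((N + 2) * (N + 2)) * (s * p - t * w))
           (x^3≡x*x*x v) (x^3≡x*x*x u) ⟩
    512 * (N * N) * ((N + 2) * (N + 2)) * (v * v * v * p - u * u * u * w)
      ≡⟨ logThirdDifference-certificate N p u v w ⟩
    _ ≡⟨ x≡y⇒p+r*[x-y]≡p _ (512 * (N * N) * (u * u * u)) (sym rec₁) ⟩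
    _ ≡⟨ x≡y⇒p+r*[x-y]≡p _ (4 * ((N + 2) * (N + 2)) * (v * v * v)) rec₀ ⟩
    _ ∎))
    ( (lit ⊕ κ ⊛ (lit ⊕ κ ⊛ (lit ⊕ κ ⊛ (lit ⊕ κ ⊛ (lit ⊕ κ ⊛ lit))))) ⊛ (ζ ⊛ ζ ⊛ ζ ⊛ ζ)
    ⊕ (lit ⊕ κ ⊛ (lit ⊕ κ ⊛ (lit ⊕ κ ⊛ (lit ⊕ κ ⊛ (lit ⊕ κ ⊛ (lit ⊕ κ)))))) ⊛ (ζ ⊛ ζ ⊛ ζ ⊛ ω)
    ⊕ (lit ⊕ κ ⊛ (lit ⊕ κ ⊛ (lit ⊕ κ ⊛ (lit ⊕ κ ⊛ (lit ⊕ κ ⊛ (lit ⊕ κ ⊛ lit)))))) ⊛ (ζ ⊛ ζ ⊛ ω ⊛ ω)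
    ⊕ (lit ⊕ κ ⊛ (lit ⊕ κ ⊛ (lit ⊕ κ ⊛ (lit ⊕ κ ⊛ (lit ⊕ κ ⊛ (lit ⊕ κ ⊛ lit)))))) ⊛ (ζ ⊛ ω ⊛ ω ⊛ ω)
    ⊕ (lit ⊕ κ ⊛ (lit ⊕ κ ⊛ (lit ⊕ κ ⊛ (lit ⊕ κ ⊛ (lit ⊕ κ ⊛ (lit ⊕ κ)))))) ⊛ (ω ⊛ ω ⊛ ω ⊛ ω))))
  where
  open ≡-Reasoning
  κ : 0ℚ ≤ℚ N - 2
  κ = p≤q⇒0≤q-p 2≤N
  ζ : 0ℚ ≤ℚ N * v - 16 * (N - 1) * u
  ζ = p≤q⇒0≤q-p lower
  ω : 0ℚ ≤ℚ 16 * N * u - (N + 1) * v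
  ω = p≤q⇒0≤q-p upper
  0<N : 0ℚ < N
  0<N = ℚ.<-≤-trans (ℚ.positive⁻¹ 2) 2≤N
  0<N+2 : 0ℚ < N + 2
  0<N+2 = ℚ.+-mono-< 0<N (ℚ.positive⁻¹ 2)
  0<scale : 0ℚ < 512 * (N * N) * ((N + 2) * (N + 2))
  0<scale = *-pos (*-pos (ℚ.positive⁻¹ 512) (*-pos 0<N 0<N)) (*-pos 0<N+2 0<N+2)

module CatalanLarcombeFrench
  (P : ℕ → ℚ)
  (P₀ : P 0 ≡ ℕ→ℚ 1)
  (P₁ : P 1 ≡ ℕ→ℚ 8)
  (rec : ∀ n → 1 ≤ n →
    ℕ→ℚ ((n +ℕ 1) *ℕ (n +ℕ 1)) * P (n +ℕ 1)
      ≡ ℕ→ℚ (8 *ℕ (3 *ℕ (n *ℕ n) +ℕ 3 *ℕ n +ℕ 1)) * P n - ℕ→ℚ (128 *ℕ (n *ℕ n)) * P (n ∸ 1))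
  where

  recurrence : ∀ n → 1 ≤ n → Recurrence (ℕ→ℚ n) (P (n ∸ 1)) (P n) (P (suc n))
  recurrence n 1≤n = begin
    (N + 1) * (N + 1) * P (suc n)
      ≡⟨ cong₂ _*_ (sym [n+1]²) (cong P (ℕ.+-comm 1 n)) ⟩
    ℕ→ℚ ((n +ℕ 1) *ℕ (n +ℕ 1)) * P (n +ℕ 1)
      ≡⟨ rec n 1≤n ⟩
    ℕ→ℚ (8 *ℕ (3 *ℕ (n *ℕ n) +ℕ 3 *ℕ n +ℕ 1)) * P n - ℕ→ℚ (128 *ℕ (n *ℕ n)) * P (n ∸ 1)
      ≡⟨ cong₂ (λ a b → a * P n - b * P (n ∸ 1)) 8[3n²+3n+1] 128n² ⟩
    8 * (3 * (N * N) + 3 * N + 1) * P n - 128 * (N * N) * P (n ∸ 1)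
      ∎
    where
    open ≡-Reasoning
    N : ℚ
    N = ℕ→ℚ n
    n² : ℕ→ℚ (n *ℕ n) ≡ N * N
    n² = ℕ→ℚ-homo-* n n
    [n+1]² : ℕ→ℚ ((n +ℕ 1) *ℕ (n +ℕ 1)) ≡ (N + 1) * (N + 1)
    [n+1]² = trans (ℕ→ℚ-homo-* (n +ℕ 1) (n +ℕ 1)) (cong₂ _*_ (ℕ→ℚ-homo-+ n 1) (ℕ→ℚ-homo-+ n 1))
    128n² : ℕ→ℚ (128 *ℕ (n *ℕ n)) ≡ 128 * (N * N)
    128n² = trans (ℕ→ℚ-homo-* 128 (n *ℕ n)) (cong (128 *_) n²)
    8[3n²+3n+1] : ℕ→ℚ (8 *ℕ (3 *ℕ (n *ℕ n) +ℕ 3 *ℕ n +ℕ 1)) ≡ 8 * (3 * (N * N) + 3 * N + 1)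
    8[3n²+3n+1] = begin
      ℕ→ℚ (8 *ℕ (3 *ℕ (n *ℕ n) +ℕ 3 *ℕ n +ℕ 1))
        ≡⟨ ℕ→ℚ-homo-* 8 (3 *ℕ (n *ℕ n) +ℕ 3 *ℕ n +ℕ 1) ⟩
      8 * ℕ→ℚ (3 *ℕ (n *ℕ n) +ℕ 3 *ℕ n +ℕ 1)
        ≡⟨ cong (8 *_) (ℕ→ℚ-homo-+ (3 *ℕ (n *ℕ n) +ℕ 3 *ℕ n) 1) ⟩
      8 * (ℕ→ℚ (3 *ℕ (n *ℕ n) +ℕ 3 *ℕ n) + 1)
        ≡⟨ cong (λ t → 8 * (t + 1)) (ℕ→ℚ-homo-+ (3 *ℕ (n *ℕ n)) (3 *ℕ n)) ⟩
      8 * (ℕ→ℚ (3 *ℕ (n *ℕ n)) + ℕ→ℚ (3 *ℕ n) + 1)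
        ≡⟨ cong₂ (λ s t → 8 * (s + t + 1))
             (trans (ℕ→ℚ-homo-* 3 (n *ℕ n)) (cong (3 *_) n²)) (ℕ→ℚ-homo-* 3 n) ⟩
      8 * (3 * (N * N) + 3 * N + 1)
        ∎

  recurrence-suc : ∀ n → Recurrence (ℕ→ℚ n + 1) (P n) (P (suc n)) (P (suc (suc n)))
  recurrence-suc n =
    subst (λ N → Recurrence N (P n) (P (suc n)) (P (suc (suc n))))
      (ℕ→ℚ-suc n) (recurrence (suc n) (s≤s z≤n))

  P₂ : P 2 ≡ 80
  P₂ = *-cancelˡ-≡ (ℚ.positive⁻¹ 4) (trans (rec 1 (s≤s z≤n)) (cong₂ (λ a b → 56 * a - 128 * b) P₁ P₀))

  P₃ : P 3 ≡ 896
  P₃ = *-cancelˡ-≡ (ℚ.positive⁻¹ 9) (trans (rec 2 (s≤s z≤n)) (cong₂ (λ a b → 152 * a - 512 * b) P₂ P₁))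

  P₄ : P 4 ≡ 10816
  P₄ = *-cancelˡ-≡ (ℚ.positive⁻¹ 16) (trans (rec 3 (s≤s z≤n)) (cong₂ (λ a b → 296 * a - 1152 * b) P₃ P₂))

  P₅ : P 5 ≡ 137728
  P₅ = *-cancelˡ-≡ (ℚ.positive⁻¹ 25) (trans (rec 4 (s≤s z≤n)) (cong₂ (λ a b → 488 * a - 2048 * b) P₄ P₃))

  P-ratioBounds : ∀ k → 0ℚ < P (4 +ℕ k) × RatioBounds (ℕ→ℚ (4 +ℕ k)) (P (4 +ℕ k)) (P (5 +ℕ k))
  P-ratioBounds zero = subst₂ (λ u v → 0ℚ < u × RatioBounds 4 u v) (sym P₄) (sym P₅)
    (ℚ.positive⁻¹ _ , ℚ.≤ᵇ⇒≤ tt , ℚ.≤ᵇ⇒≤ tt)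
  P-ratioBounds (suc k) with P-ratioBounds k
  ... | 0<u , bounds =
    ratioBounds-pos (ℚ.<-≤-trans (from-yes (1 ℚ.<? 4)) 4≤N) 0<u bounds ,
    subst (λ N → RatioBounds N (P (5 +ℕ k)) (P (6 +ℕ k))) (sym (ℕ→ℚ-suc (4 +ℕ k)))
      (ratioBounds-step 4≤N (recurrence-suc (4 +ℕ k)) bounds)
    where
    4≤N : 4 ≤ℚ ℕ→ℚ (4 +ℕ k)
    4≤N = ℕ→ℚ-mono-≤ (ℕ.m≤m+n 4 k)

  P-pos : ∀ n → 0ℚ < P n
  P-pos 0 = subst (0ℚ <_) (sym P₀) (ℚ.positive⁻¹ _)
  P-pos 1 = subst (0ℚ <_) (sym P₁) (ℚ.positive⁻¹ _)
  P-pos 2 = subst (0ℚ <_) (sym P₂) (ℚ.positive⁻¹ _)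
  P-pos 3 = subst (0ℚ <_) (sym P₃) (ℚ.positive⁻¹ _)
  P-pos (suc (suc (suc (suc k)))) = proj₁ (P-ratioBounds k)

  P-logThirdDifference≤0 : ∀ n → 2 ≤ n → P n ^ℚ 3 * P (suc (suc n)) ≤ℚ P (suc n) ^ℚ 3 * P (n ∸ 1)
  P-logThirdDifference≤0 2 _ =
    subst₂ _≤ℚ_ (sym (cong₂ (λ u w → u ^ℚ 3 * w) P₂ P₄)) (sym (cong₂ (λ v p → v ^ℚ 3 * p) P₃ P₁))
      (ℚ.≤ᵇ⇒≤ tt)
  P-logThirdDifference≤0 3 _ =
    subst₂ _≤ℚ_ (sym (cong₂ (λ u w → u ^ℚ 3 * w) P₃ P₅)) (sym (cong₂ (λ v p → v ^ℚ 3 * p) P₄ P₂))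
      (ℚ.≤ᵇ⇒≤ tt)
  P-logThirdDifference≤0 n@(suc (suc (suc (suc k)))) _ =
    logThirdDifference≤0 (ℕ→ℚ-mono-≤ {2} {n} (s≤s (s≤s z≤n))) (recurrence n (s≤s z≤n)) (recurrence-suc n)
      (proj₂ (P-ratioBounds k))
  P-logThirdDifference≤0 1 (s≤s ())

  P-rootLogConcaveAt-2 : RootLogConcaveAt P 2
  P-rootLogConcaveAt-2 =
    subst₂ _<_ (sym (cong₂ (λ p v → p ^ℚ 6 * v ^ℚ 2) P₁ P₃)) (sym (cong (_^ℚ 6) P₂))
      (toWitness {a? = _ ℚ.<? _} tt)

theorem1p1 : (P : ℕ → ℚ) →
    P 0 ≡ ℕ→ℚ 1 →
    P 1 ≡ ℕ→ℚ 8 →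
    (∀ n → 1 ≤ n →
      ℕ→ℚ ((n +ℕ 1) *ℕ (n +ℕ 1)) * P (n +ℕ 1)
        ≡ ℕ→ℚ (8 *ℕ (3 *ℕ (n *ℕ n) +ℕ 3 *ℕ n +ℕ 1)) * P n
          - ℕ→ℚ (128 *ℕ (n *ℕ n)) * P (n ∸ 1)) →
    ∀ n → 2 ≤ n →
      P (n ∸ 1) ^ℚ (n *ℕ (n +ℕ 1)) * P (n +ℕ 1) ^ℚ (n *ℕ (n ∸ 1))
        < P n ^ℚ (2 *ℕ (n *ℕ n ∸ 1))
theorem1p1 P P₀ P₁ rec n 2≤n =
  subst (λ k → P (n ∸ 1) ^ℚ (n *ℕ (n +ℕ 1)) * P k ^ℚ (n *ℕ (n ∸ 1)) < P n ^ℚ (2 *ℕ (n *ℕ n ∸ 1)))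
    (ℕ.+-comm 1 n)
    (rootLogConcave P P-pos P-logThirdDifference≤0 P-rootLogConcaveAt-2 n 2≤n)
  where open CatalanLarcombeFrench P P₀ P₁ rec
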